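{- Let $\lambda=(\lambda_1,\dots,\lambda_r)$ be a composition, with translation parameters $s_i=\sum_{j>i}\lambda_j-\sum_{j<i}\lambda_j$ for $i\in\{1,\dots,r\}$. Then there exists an integer $t\in\{1,\dots,r\}$ such that $\lambda_t\geq |s_t|$.
   Context: A composition of $n$ is a finite sequence $(\lambda_1,\dots,\lambda_r)$ of positive integers with sum $n$. The numbers $s_i$ are called the translation parameters of $\lambda$. -}

module Defs where

open import Data.Nat using (ℕ)
open import Data.Nat.ListAction using (sum)
open import Data.Fin using (Fin; toℕ)
open import Data.List using (List; map; filter)
open import Data.List.Base using (allFin)
open import Data.Integer using (ℤ; _-_; +_)

-- A composition (λ₁,…,λᵣ) is encoded as a function λ : Fin r → ℕ
-- (positivity of the parts is a hypothesis of the theorem).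

sumAfter : {r : ℕ} → (Fin r → ℕ) → Fin r → ℕ
sumAfter {r} lam i = sum (map lam (filter (λ j → i Data.Fin.<? j) (allFin r)))

sumBefore : {r : ℕ} → (Fin r → ℕ) → Fin r → ℕ
sumBefore {r} lam i = sum (map lam (filter (λ j → j Data.Fin.<? i) (allFin r)))

transParam : {r : ℕ} → (Fin r → ℕ) → Fin r → ℤ
transParam lam i = + sumAfter lam i - + sumBefore lam i

-- Write Aₜ and Bₜ for the sums of the parts before and after t, and put an
-- extra weight a on the left of the composition, so that t is balanced when
-- ∣Bₜ − (a + Aₜ)∣ ≤ λₜ.  If a is at most the total weight, a balanced index
-- exists: either t = 1 is balanced, or B₁ > a + λ₁, and then the weight a + λ₁
-- is at most the total weight of the composition (λ₂,…,λᵣ), whose balanced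
-- indices are balanced indices of λ for the weight a.  The theorem is the case
-- a = 0.
module Submission where

open import Defs
open import Data.Nat using (ℕ; _≤_; _>_)
open import Data.Fin using (Fin)
open import Data.Integer using (∣_∣)
open import Data.Product using (∃)

open import Level using (Level)
open import Data.Bool using (true; false)
open import Data.Empty using (⊥-elim)
open import Data.Nat using (zero; suc; _+_; z≤n; s≤s; s≤s⁻¹; z<s)
open import Data.Nat.Properties
  using (_≤?_; ≤-total; ≰⇒>; <⇒≤; +-identityʳ; +-comm; +-assoc; m≤n+o⇒m∸n≤o)
open import Data.Nat.ListAction using (sum)
open import Data.Nat.ListAction.Properties using (sum-++)
open import Data.Fin using () renaming (zero to fzero; suc to fsuc)
open import Data.Fin.Properties using (_<?_)
open import Data.List using (List; []; _∷_; [_]; _++_; map; filter; allFin)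
open import Data.List.Properties using (map-++; map-∘; map-tabulate; filter-++; filter-all; filter-none; filter-≐)
open import Data.List.Relation.Unary.All using (universal)
open import Data.Product using (_,_; _×_)
open import Data.Sum using (inj₁; inj₂)
open import Function using (_∘_; id)
open import Relation.Nullary using (does; yes; no)
open import Relation.Unary using (Pred; Decidable)
open import Relation.Binary.PropositionalEquality
  using (_≡_; refl; sym; trans; cong; cong₂; subst; module ≡-Reasoning)
import Data.Integer as ℤ
import Data.Integer.Properties as ℤ

private
  variable
    a p : Level
    A B : Set a

filter-map : ∀ {P : Pred B p} (f : A → B) (P? : Decidable P) (xs : List A) →
             filter P? (map f xs) ≡ map f (filter (P? ∘ f) xs)
filter-map f P? []       = refl
filter-map f P? (x ∷ xs) with does (P? (f x))
... | true  = cong (f x ∷_) (filter-map f P? xs)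
... | false = filter-map f P? xs

allFin-suc : ∀ n → allFin (suc n) ≡ fzero ∷ map fsuc (allFin n)
allFin-suc n = cong (fzero ∷_) (sym (map-tabulate id fsuc))

module _ {n : ℕ} (lam : Fin (suc n) → ℕ) where
  open ≡-Reasoning

  sum-filter-allFin-suc : ∀ {P : Pred (Fin (suc n)) p} (P? : Decidable P) →
    sum (map lam (filter P? (allFin (suc n)))) ≡
    sum (map lam (filter P? [ fzero ])) + sum (map (lam ∘ fsuc) (filter (P? ∘ fsuc) (allFin n)))
  sum-filter-allFin-suc P? = begin
    sum (map lam (filter P? (allFin (suc n))))
      ≡⟨ cong (sum ∘ map lam ∘ filter P?) (allFin-suc n) ⟩
    sum (map lam (filter P? ([ fzero ] ++ map fsuc (allFin n))))
      ≡⟨ cong (sum ∘ map lam) (filter-++ P? [ fzero ] (map fsuc (allFin n))) ⟩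
    sum (map lam (filter P? [ fzero ] ++ filter P? (map fsuc (allFin n))))
      ≡⟨ cong sum (map-++ lam (filter P? [ fzero ]) _) ⟩
    sum (map lam (filter P? [ fzero ]) ++ map lam (filter P? (map fsuc (allFin n))))
      ≡⟨ sum-++ (map lam (filter P? [ fzero ])) _ ⟩
    sum (map lam (filter P? [ fzero ])) + sum (map lam (filter P? (map fsuc (allFin n))))
      ≡⟨ cong (λ xs → sum (map lam (filter P? [ fzero ])) + sum (map lam xs)) (filter-map fsuc P? (allFin n)) ⟩
    sum (map lam (filter P? [ fzero ])) + sum (map lam (map fsuc (filter (P? ∘ fsuc) (allFin n))))
      ≡⟨ cong (λ xs → sum (map lam (filter P? [ fzero ])) + sum xs) (map-∘ (filter (P? ∘ fsuc) (allFin n))) ⟨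
    sum (map lam (filter P? [ fzero ])) + sum (map (lam ∘ fsuc) (filter (P? ∘ fsuc) (allFin n))) ∎

  sumBefore-zero : sumBefore lam fzero ≡ 0
  sumBefore-zero = begin
    sumBefore lam fzero
      ≡⟨ sum-filter-allFin-suc (_<? fzero {n}) ⟩
    sum (map (lam ∘ fsuc) (filter ((_<? fzero {n}) ∘ fsuc) (allFin n)))
      ≡⟨ cong (sum ∘ map (lam ∘ fsuc)) (filter-none ((_<? fzero {n}) ∘ fsuc) (universal (λ _ ()) (allFin n))) ⟩
    0 ∎

  sumAfter-zero : sumAfter lam fzero ≡ sum (map (lam ∘ fsuc) (allFin n))
  sumAfter-zero = begin
    sumAfter lam fzero
      ≡⟨ sum-filter-allFin-suc (fzero {n} <?_) ⟩
    sum (map (lam ∘ fsuc) (filter ((fzero {n} <?_) ∘ fsuc) (allFin n)))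
      ≡⟨ cong (sum ∘ map (lam ∘ fsuc)) (filter-all ((fzero {n} <?_) ∘ fsuc) (universal (λ _ → z<s) (allFin n))) ⟩
    sum (map (lam ∘ fsuc) (allFin n)) ∎

  sumAfter-suc : ∀ i → sumAfter lam (fsuc i) ≡ sumAfter (lam ∘ fsuc) i
  sumAfter-suc i = begin
    sumAfter lam (fsuc i)
      ≡⟨ sum-filter-allFin-suc (fsuc i <?_) ⟩
    sum (map (lam ∘ fsuc) (filter ((fsuc i <?_) ∘ fsuc) (allFin n)))
      ≡⟨ cong (sum ∘ map (lam ∘ fsuc)) (filter-≐ ((fsuc i <?_) ∘ fsuc) (i <?_) (s≤s⁻¹ , s≤s) (allFin n)) ⟩
    sumAfter (lam ∘ fsuc) i ∎

  sumBefore-suc : ∀ i → sumBefore lam (fsuc i) ≡ lam fzero + sumBefore (lam ∘ fsuc) i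
  sumBefore-suc i = begin
    sumBefore lam (fsuc i)
      ≡⟨ sum-filter-allFin-suc (_<? fsuc i) ⟩
    lam fzero + 0 + sum (map (lam ∘ fsuc) (filter ((_<? fsuc i) ∘ fsuc) (allFin n)))
      ≡⟨ cong₂ _+_ (+-identityʳ (lam fzero)) (cong (sum ∘ map (lam ∘ fsuc)) (filter-≐ ((_<? fsuc i) ∘ fsuc) (_<? i) (s≤s⁻¹ , s≤s) (allFin n))) ⟩
    lam fzero + sumBefore (lam ∘ fsuc) i ∎

sum-allFin-suc : ∀ {n} (g : Fin (suc n) → ℕ) →
                 sum (map g (allFin (suc n))) ≡ g fzero + sum (map (g ∘ fsuc) (allFin n))
sum-allFin-suc g =
  cong (λ xs → g fzero + sum xs) (trans (map-tabulate fsuc g) (sym (map-tabulate id (g ∘ fsuc))))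

sumAfter-zero-suc : ∀ {n} (lam : Fin (suc (suc n)) → ℕ) →
                    sumAfter lam fzero ≡ lam (fsuc fzero) + sumAfter (lam ∘ fsuc) fzero
sumAfter-zero-suc lam = begin
  sumAfter lam fzero                                          ≡⟨ sumAfter-zero lam ⟩
  sum (map (lam ∘ fsuc) (allFin _))                           ≡⟨ sum-allFin-suc (lam ∘ fsuc) ⟩
  lam (fsuc fzero) + sum (map (lam ∘ fsuc ∘ fsuc) (allFin _)) ≡⟨ cong (lam (fsuc fzero) +_) (sumAfter-zero (lam ∘ fsuc)) ⟨
  lam (fsuc fzero) + sumAfter (lam ∘ fsuc) fzero              ∎
  where open ≡-Reasoning

Balanced : ∀ {n} → (Fin n → ℕ) → ℕ → Fin n → Set
Balanced lam a t = sumAfter lam t ≤ (a + sumBefore lam t) + lam t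
                 × a + sumBefore lam t ≤ sumAfter lam t + lam t

balanced-zero : ∀ {n a} (lam : Fin (suc n) → ℕ) →
                sumAfter lam fzero ≤ a + lam fzero → a ≤ lam fzero + sumAfter lam fzero →
                Balanced lam a fzero
balanced-zero {a = a} lam after≤ a≤total rewrite sumBefore-zero lam | +-identityʳ a =
  after≤ , subst (a ≤_) (+-comm (lam fzero) _) a≤total

balanced-suc : ∀ {n a t} (lam : Fin (suc n) → ℕ) →
               Balanced (lam ∘ fsuc) (a + lam fzero) t → Balanced lam a (fsuc t)
balanced-suc {a = a} {t} lam (after≤ , before≤)
  rewrite sumAfter-suc lam t | sumBefore-suc lam t | +-assoc a (lam fzero) (sumBefore (lam ∘ fsuc) t) =
  after≤ , before≤

balanced-exists : ∀ n (lam : Fin (suc n) → ℕ) a → a ≤ lam fzero + sumAfter lam fzero → ∃ (Balanced lam a)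
balanced-exists n lam a a≤total with sumAfter lam fzero ≤? a + lam fzero
... | yes after≤ = fzero , balanced-zero lam after≤ a≤total
balanced-exists zero    lam a a≤total | no after≰ =
  ⊥-elim (after≰ (subst (_≤ a + lam fzero) (sym (sumAfter-zero lam)) z≤n))
balanced-exists (suc n) lam a a≤total | no after≰ with balanced-exists n (lam ∘ fsuc) (a + lam fzero)
  (subst (a + lam fzero ≤_) (sumAfter-zero-suc lam) (<⇒≤ (≰⇒> after≰)))
... | t , balanced = fsuc t , balanced-suc lam balanced

∣+m-+n∣≤o : ∀ {m n o} → m ≤ n + o → n ≤ m + o → ∣ ℤ.+ m ℤ.- ℤ.+ n ∣ ≤ o
∣+m-+n∣≤o {m} {n} m≤n+o n≤m+o rewrite ℤ.m-n≡m⊖n m n with ≤-total m n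
... | inj₁ m≤n rewrite ℤ.∣⊖∣-≤ m≤n = m≤n+o⇒m∸n≤o n m n≤m+o
... | inj₂ n≤m rewrite ℤ.∣m⊖n∣≡∣n⊖m∣ m n | ℤ.∣⊖∣-≤ n≤m = m≤n+o⇒m∸n≤o m n m≤n+o

lemma2 : (r : ℕ) → 1 ≤ r → (lam : Fin r → ℕ) → (∀ i → lam i > 0) →
    ∃ λ (t : Fin r) → ∣ transParam lam t ∣ ≤ lam t
lemma2 (suc r) _ lam _ with balanced-exists r lam 0 z≤n
... | t , after≤ , before≤ = t , ∣+m-+n∣≤o after≤ before≤
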